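{- Let $(V,\in)$ be an $\in$-structure. Then every element of $V_{\mathrm{Acc}}$ is accessible with respect to the relation $\in_{\mathrm{Acc}}$; that is, the $\in$-structure $(V_{\mathrm{Acc}},\in_{\mathrm{Acc}})$ has foundation.
   Context: Homotopy type theory with univalent universes and function extensionality. An $\in$-structure is a type $V$ with $\in:V\to V\to\mathsf{Type}$ such that for all $x,y:V$ the canonical map $(x=y)\to\prod_{z:V}(z\in x\simeq z\in y)$ is an equivalence. For a relation $\in$ on $V$, the accessibility predicate $\mathrm{Acc}:V\to\mathsf{Type}$ is defined inductively by the single constructor $\mathrm{acc}:\prod_{x:V}\big(\prod_{y:V}y\in x\to\mathrm{Acc}\,y\big)\to\mathrm{Acc}\,x$ (it is a proposition). Define $V_{\mathrm{Acc}}:=\sum_{x:V}\mathrm{Acc}\,x$ and $x\in_{\mathrm{Acc}}y:=\pi_0x\in\pi_0y$; $(V_{\mathrm{Acc}},\in_{\mathrm{Acc}})$ is again an $\in$-structure. An $\in$-structure $(W,\in')$ has foundation if every $w:W$ is accessible with respect to $\in'$. -}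

module Defs where

open import Level using (Level; _⊔_)
open import Data.Product using (Σ; _,_; proj₁; proj₂; _×_)
open import Relation.Binary.PropositionalEquality using (_≡_; refl)
open import Function using (id; _∘_)

isEquiv : ∀ {a b} {A : Set a} {B : Set b} → (A → B) → Set (a ⊔ b)
isEquiv {A = A} {B} f =
  (Σ (B → A) λ g → ∀ y → f (g y) ≡ y) × (Σ (B → A) λ h → ∀ x → h (f x) ≡ x)

_≃_ : ∀ {a b} → Set a → Set b → Set (a ⊔ b)
A ≃ B = Σ (A → B) isEquiv

idEquiv : ∀ {a} (A : Set a) → A ≃ A
idEquiv A = id , ((id , λ _ → refl) , (id , λ _ → refl))

canonical : ∀ {ℓ ℓ'} {V : Set ℓ} (_∈_ : V → V → Set ℓ') (x y : V) →
            x ≡ y → (z : V) → (z ∈ x) ≃ (z ∈ y)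
canonical _∈_ x .x refl z = idEquiv (z ∈ x)

is-∈-structure : ∀ {ℓ ℓ'} (V : Set ℓ) (_∈_ : V → V → Set ℓ') → Set (ℓ ⊔ ℓ')
is-∈-structure V _∈_ = ∀ x y → isEquiv (canonical _∈_ x y)

data Acc {ℓ ℓ'} {V : Set ℓ} (_∈_ : V → V → Set ℓ') : V → Set (ℓ ⊔ ℓ') where
  acc : (x : V) → ((y : V) → y ∈ x → Acc _∈_ y) → Acc _∈_ x

V-Acc : ∀ {ℓ ℓ'} (V : Set ℓ) (_∈_ : V → V → Set ℓ') → Set (ℓ ⊔ ℓ')
V-Acc V _∈_ = Σ V (Acc _∈_)

∈-Acc : ∀ {ℓ ℓ'} {V : Set ℓ} (_∈_ : V → V → Set ℓ') → V-Acc V _∈_ → V-Acc V _∈_ → Set ℓ'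
∈-Acc _∈_ x y = proj₁ x ∈ proj₁ y

has-foundation : ∀ {ℓ ℓ'} (W : Set ℓ) (_∈'_ : W → W → Set ℓ') → Set (ℓ ⊔ ℓ')
has-foundation W _∈'_ = (w : W) → Acc _∈'_ w

-- Accessibility of x w.r.t. ∈ lifts to every point (x , p) of Σ V P under the
-- restricted relation, by induction on Acc x; the second component is never
-- inspected. Taking P = Acc gives foundation.
module Submission where

open import Data.Product using (Σ; _,_; proj₁)
open import Defs

Restrict : ∀ {ℓ ℓ' p} {V : Set ℓ} (P : V → Set p) →
           (V → V → Set ℓ') → Σ V P → Σ V P → Set ℓ'
Restrict P _∈_ x y = proj₁ x ∈ proj₁ y

Acc-restrict : ∀ {ℓ ℓ' p} {V : Set ℓ} {_∈_ : V → V → Set ℓ'} {P : V → Set p}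
               {x : V} → Acc _∈_ x → (px : P x) → Acc (Restrict P _∈_) (x , px)
Acc-restrict (acc x below) px =
  acc (x , px) λ { (y , py) y∈x → Acc-restrict (below y y∈x) py }

mainTheorem19 : ∀ {ℓ ℓ'} (V : Set ℓ) (_∈_ : V → V → Set ℓ') →
    is-∈-structure V _∈_ →
    has-foundation (V-Acc V _∈_) (∈-Acc _∈_)
mainTheorem19 V _∈_ _ (x , accx) = Acc-restrict accx accx
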